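{- Exhaustive blocked clause elimination is not symmetry-lifting: there exist CNF formulas $F$ and $F^*$ such that $F^*$ is obtained from $F$ by removing blocked clauses until no clause is blocked, and $\mathrm{Aut}_{\mathrm{sem}}(F^*)\uparrow^{\mathrm{Lit}(F)}\not\subseteq\mathrm{Aut}_{\mathrm{sem}}(F)$.
   Context: Literals: each variable $v$ gives literals $v,\bar v$ with $\bar{\bar v}=v$. A CNF formula $F$ is a finite set of clauses, each a finite set of literals; $\mathrm{Var}(F)$ is the set of variables occurring in $F$, $\mathrm{Lit}(F):=\mathrm{Var}(F)\cup\{\bar v:v\in\mathrm{Var}(F)\}$. An assignment of $F$ is a consistent map $\sigma:L\to\{\bot,\top\}$, $L\subseteq\mathrm{Lit}(F)$ ($\sigma(v)=\top$ iff $\sigma(\bar v)=\bot$), complete if $L=\mathrm{Lit}(F)$; write $l\in\sigma$ iff $\sigma(l)=\top$. For a formula $G$: $G[\sigma]:=\{C[\sigma]:C\in G,\ \nexists l\,(l\in\sigma\wedge l\in C)\}$ with $C[\sigma]:=\{l\in C:\bar l\notin\sigma\}$. Bijections of literals act elementwise on clauses and formulas. A semantic symmetry of $F$ is a bijection $\varphi:\mathrm{Lit}(F)\to\mathrm{Lit}(F)$ with $\overline{\varphi(l)}=\varphi(\bar l)$ for all $l$ and $F[\sigma]=\varphi(F)[\sigma]$ for all complete assignments $\sigma$ of $F$; $\mathrm{Aut}_{\mathrm{sem}}(F)$ is the group of these. For a permutation group $\Gamma$ on $\Omega\subseteq\Omega'$, $\Gamma\uparrow^{\Omega'}$ consists of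 the extensions of each $\varphi\in\Gamma$ by the identity on $\Omega'\setminus\Omega$. For clauses $C_1\ni x$, $C_2\ni\bar x$, the resolvent is $C_1\circ_x C_2:=(C_1\setminus\{x\})\cup(C_2\setminus\{\bar x\})$. A literal $l\in C$ blocks the clause $C\in F$ if for every $C'\in F$ with $\bar l\in C'$, the resolvent $C\circ_l C'$ is a tautology (contains some literal together with its negation). $C$ is blocked if some literal blocks it. Blocked clause elimination transforms $F$ into $F\setminus\{C\}$ for a blocked clause $C\in F$. -}

module Defs where

open import Data.Nat using (ℕ)
open import Data.Bool using (Bool; true; false)
open import Data.List using (List; map)
open import Data.List.Membership.Propositional using (_∈_)
open import Data.Product using (Σ; ∃; _×_; _,_)
open import Data.Sum using (_⊎_)
open import Relation.Nullary using (¬_)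
open import Relation.Binary.PropositionalEquality using (_≡_; _≢_)
open import Relation.Binary.Construct.Closure.ReflexiveTransitive using (Star)
open import Function.Bundles using (_⇔_)

data Lit : Set where
  pos : ℕ → Lit
  neg : ℕ → Lit

‾ : Lit → Lit
‾ (pos v) = neg v
‾ (neg v) = pos v

var : Lit → ℕ
var (pos v) = v
var (neg v) = v

-- Clauses and formulas are finite sets, represented by lists; all
-- notions below are invariant under reordering / duplication
-- (equality of clauses is extensional, see _≈C_).
Clause : Set
Clause = List Lit

Formula : Set
Formula = List Clause

_≈C_ : Clause → Clause → Set
C ≈C D = ∀ l → (l ∈ C) ⇔ (l ∈ D)

_∈F_ : Clause → Formula → Set
D ∈F G = ∃ λ C → C ∈ G × D ≈C C

_∈Lit_ : Lit → Formula → Set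
l ∈Lit F = ∃ λ C → C ∈ F × (l ∈ C ⊎ ‾ l ∈ C)

-- A complete assignment of F is given by a valuation σ of the variables
-- (only its values on Var(F) matter).  l ∈σ means σ(l) = ⊤, which only
-- makes sense for l ∈ Lit(F).
evalLit : (ℕ → Bool) → Lit → Bool
evalLit σ (pos v) = σ v
evalLit σ (neg v) = Data.Bool.not (σ v)

TrueIn : Formula → (ℕ → Bool) → Lit → Set
TrueIn F σ l = l ∈Lit F × evalLit σ l ≡ true

-- D ∈ G[σ], σ a complete assignment of F:
-- G[σ] = { C[σ] : C ∈ G, no l ∈ C with l ∈ σ },  C[σ] = { l ∈ C : l̄ ∉ σ }.
InRestr : Formula → (ℕ → Bool) → Formula → Clause → Set
InRestr F σ G D =
  ∃ λ C → C ∈ G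
        × (∀ l → l ∈ C → ¬ TrueIn F σ l)
        × (∀ l → (l ∈ D) ⇔ (l ∈ C × ¬ TrueIn F σ (‾ l)))

applyF : (Lit → Lit) → Formula → Formula
applyF φ F = map (map φ) F

record SemSym (F : Formula) (φ : Lit → Lit) : Set where
  field
    into   : ∀ l → l ∈Lit F → φ l ∈Lit F
    inj    : ∀ k l → k ∈Lit F → l ∈Lit F → φ k ≡ φ l → k ≡ l
    surj   : ∀ l → l ∈Lit F → ∃ λ k → k ∈Lit F × φ k ≡ l
    negcom : ∀ l → l ∈Lit F → ‾ (φ l) ≡ φ (‾ l)
    sem    : ∀ (σ : ℕ → Bool) (D : Clause) →
               InRestr F σ F D ⇔ InRestr F σ (applyF φ F) D

InResolvent : Clause → Lit → Clause → Lit → Set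
InResolvent C₁ x C₂ k = (k ∈ C₁ × k ≢ x) ⊎ (k ∈ C₂ × k ≢ ‾ x)

Tautological : (Lit → Set) → Set
Tautological P = ∃ λ k → P k × P (‾ k)

Blocks : Formula → Lit → Clause → Set
Blocks F l C = l ∈ C × (∀ C' → C' ∈ F → ‾ l ∈ C' → Tautological (InResolvent C l C'))

Blocked : Formula → Clause → Set
Blocked F C = ∃ λ l → Blocks F l C

BCEStep : Formula → Formula → Set
BCEStep F F' = ∃ λ C → C ∈F F × Blocked F C
             × (∀ D → D ∈F F' ⇔ (D ∈F F × ¬ (D ≈C C)))

ExhaustiveBCE : Formula → Formula → Set
ExhaustiveBCE F F* = Star BCEStep F F* × (∀ C → C ∈ F* → ¬ Blocked F* C)

LiftOf : Formula → Formula → (Lit → Lit) → (Lit → Lit) → Set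
LiftOf F* F φ ψ = (∀ l → l ∈Lit F* → ψ l ≡ φ l)
                × (∀ l → l ∈Lit F → ¬ (l ∈Lit F*) → ψ l ≡ l)

-- Blocked clause elimination may delete a clause that breaks an extra
-- symmetry: in F = {a ∨ d, a ∨ b, ā ∨ c, b̄ ∨ c̄} the literal d is pure, so
-- a ∨ d is blocked, while the remaining F* is closed under the syntactic
-- symmetry a ↔ b, c ↔ c̄ and has no blocked clause.  Lifted to F, that symmetry
-- maps a ∨ d to b ∨ d, which the assignment a = c = ⊤, b = d = ⊥ falsifies
-- although it satisfies every clause of F.
module Submission where

open import Defs
open import Data.Bool using (Bool; true; false; not)
open import Data.Bool.Properties using (not-involutive)
open import Data.Empty using (⊥-elim)
open import Data.List using ([]; _∷_; _++_; map; filter)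
open import Data.List.Membership.Propositional using (_∈_; _∉_)
open import Data.List.Membership.Propositional.Properties using (∈-map⁺; ∈-filter⁺; ∈-++⁺ˡ; ∈-++⁺ʳ)
open import Data.List.Relation.Unary.All using (All; all?; lookup)
open import Data.List.Relation.Unary.Any using (here; there)
open import Data.Nat using (ℕ; suc)
import Data.Nat.Properties as ℕ
open import Data.Product using (∃; _×_; _,_; proj₂)
open import Data.Sum using (_⊎_; inj₁; inj₂; fromInj₂)
open import Function.Bundles using (mk⇔; Equivalence)
open import Relation.Binary.Construct.Closure.ReflexiveTransitive using (ε; _◅_)
open import Relation.Binary.Definitions using (DecidableEquality)
open import Relation.Binary.PropositionalEquality using (_≡_; refl; sym; trans; cong; subst)
open import Relation.Nullary using (¬_; Dec; yes; no; ¬?)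
open import Relation.Nullary.Decidable using (True; toWitness)

open Equivalence

_≟L_ : DecidableEquality Lit
pos m ≟L pos n with m ℕ.≟ n
... | yes refl = yes refl
... | no m≢n   = no λ { refl → m≢n refl }
neg m ≟L neg n with m ℕ.≟ n
... | yes refl = yes refl
... | no m≢n   = no λ { refl → m≢n refl }
pos _ ≟L neg _ = no λ ()
neg _ ≟L pos _ = no λ ()

open import Data.List.Membership.DecPropositional _≟L_ using (_∈?_)

evalLit-‾ : ∀ σ l → evalLit σ (‾ l) ≡ not (evalLit σ l)
evalLit-‾ σ (pos v) = refl
evalLit-‾ σ (neg v) = sym (not-involutive (σ v))

evalLit-‾-true : ∀ σ l → evalLit σ l ≡ true → evalLit σ (‾ l) ≡ false
evalLit-‾-true σ l l-true = trans (evalLit-‾ σ l) (cong not l-true)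

occurs⇒∈Lit : ∀ {F C l} → C ∈ F → l ∈ C → l ∈Lit F
occurs⇒∈Lit C∈F l∈C = _ , C∈F , inj₁ l∈C

occurs‾⇒∈Lit : ∀ {F C l} → C ∈ F → ‾ l ∈ C → l ∈Lit F
occurs‾⇒∈Lit C∈F l̄∈C = _ , C∈F , inj₂ l̄∈C

absentFrom : ∀ l G → {True (all? (λ C → ¬? (l ∈? C)) G)} → ∀ C → C ∈ G → l ∉ C
absentFrom l G {w} C C∈G = lookup (toWitness w) C∈G

≈C-refl : ∀ {C} → C ≈C C
≈C-refl l = mk⇔ (λ x → x) (λ x → x)

≈C-sym : ∀ {C D} → C ≈C D → D ≈C C
≈C-sym C≈D l = mk⇔ (from (C≈D l)) (to (C≈D l))

≈C-trans : ∀ {C D E} → C ≈C D → D ≈C E → C ≈C E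
≈C-trans C≈D D≈E l = mk⇔ (λ x → to (D≈E l) (to (C≈D l) x)) (λ x → from (C≈D l) (from (D≈E l) x))

≈C-swap : ∀ k l → (k ∷ l ∷ []) ≈C (l ∷ k ∷ [])
≈C-swap k l _ = mk⇔ swap swap
  where
  swap : ∀ {x y m : Lit} → m ∈ x ∷ y ∷ [] → m ∈ y ∷ x ∷ []
  swap (here p)         = there (here p)
  swap (there (here p)) = here p

literal⇒∉F : ∀ {l C G} → l ∈ C → (∀ C' → C' ∈ G → l ∉ C') → ¬ C ∈F G
literal⇒∉F l∈C absent (C' , C'∈G , C≈C') = absent C' C'∈G (to (C≈C' _) l∈C)

_⊑_ : Formula → Formula → Set
G ⊑ G' = ∀ C → C ∈ G → C ∈F G'

InRestr-mono : ∀ {F σ G G' D} → G ⊑ G' → InRestr F σ G D → InRestr F σ G' D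
InRestr-mono G⊑G' (C , C∈G , unsat , D≡C[σ]) with G⊑G' C C∈G
... | C' , C'∈G' , C≈C' =
  C' , C'∈G' , (λ l l∈C' → unsat l (from (C≈C' l) l∈C')) ,
  λ l → mk⇔ (λ l∈D → let l∈C , ¬l̄ = to (D≡C[σ] l) l∈D in to (C≈C' l) l∈C , ¬l̄)
            (λ { (l∈C' , ¬l̄) → from (D≡C[σ] l) (from (C≈C' l) l∈C' , ¬l̄) })

syntactic⇒SemSym : ∀ {F φ} → (∀ l → φ (φ l) ≡ l) → (∀ l → ‾ (φ l) ≡ φ (‾ l)) →
                   F ⊑ applyF φ F → applyF φ F ⊑ F → SemSym F φ
syntactic⇒SemSym {F} {φ} involutive ‾-commutes F⊑φF φF⊑F = record
  { into   = into
  ; inj    = λ k l _ _ φk≡φl → trans (sym (involutive k)) (trans (cong φ φk≡φl) (involutive l))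
  ; surj   = λ l l∈F → φ l , into l l∈F , involutive l
  ; negcom = λ l _ → ‾-commutes l
  ; sem    = λ σ D → mk⇔ (InRestr-mono F⊑φF) (InRestr-mono φF⊑F)
  }
  where
  image : ∀ {C k} → C ∈ F → k ∈ C → ∃ λ C' → C' ∈ F × φ k ∈ C'
  image {C} C∈F k∈C with φF⊑F (map φ C) (∈-map⁺ (map φ) C∈F)
  ... | C' , C'∈F , φC≈C' = C' , C'∈F , to (φC≈C' _) (∈-map⁺ φ k∈C)

  into : ∀ l → l ∈Lit F → φ l ∈Lit F
  into l (_ , C∈F , inj₁ l∈C) with image C∈F l∈C
  ... | C' , C'∈F , φl∈C' = C' , C'∈F , inj₁ φl∈C'
  into l (_ , C∈F , inj₂ l̄∈C) with image C∈F l̄∈C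
  ... | C' , C'∈F , φl̄∈C' = C' , C'∈F , inj₂ (subst (_∈ C') (sym (‾-commutes l)) φl̄∈C')

liftOf-self : ∀ {F* F φ} → (∀ l → l ∈Lit F* ⊎ φ l ≡ l) → LiftOf F* F φ φ
liftOf-self inF*⊎fixed =
  (λ _ _ → refl) , λ l _ l∉F* → fromInj₂ (λ l∈F* → ⊥-elim (l∉F* l∈F*)) (inF*⊎fixed l)

satisfied⇒¬InRestr : ∀ {F σ G D} → (∀ C → C ∈ G → ∃ λ l → l ∈ C × TrueIn F σ l) →
                     ¬ InRestr F σ G D
satisfied⇒¬InRestr satisfied (C , C∈G , unsat , _) =
  let l , l∈C , l-true = satisfied C C∈G in unsat l l∈C l-true

falsified⇒[]∈Restr : ∀ {F σ G C} → C ∈ G → (∀ l → l ∈ C → TrueIn F σ (‾ l)) →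
                     InRestr F σ G []
falsified⇒[]∈Restr {σ = σ} C∈G falsified =
  _ , C∈G , unsat , λ l → mk⇔ (λ ()) λ { (l∈C , ¬l̄) → ⊥-elim (¬l̄ (falsified l l∈C)) }
  where
  unsat : ∀ l → l ∈ _ → ¬ TrueIn _ σ l
  unsat l l∈C (_ , l-true) with trans (sym (evalLit-‾-true σ l l-true)) (proj₂ (falsified l l∈C))
  ... | ()

pure⇒Blocks : ∀ {F l C} → l ∈ C → (∀ C' → C' ∈ F → ‾ l ∉ C') → Blocks F l C
pure⇒Blocks l∈C pure = l∈C , λ C' C'∈F l̄∈C' → ⊥-elim (pure C' C'∈F l̄∈C')

removeBlocked : ∀ {C G} → Blocked (C ∷ G) C → ¬ C ∈F G → BCEStep (C ∷ G) G
removeBlocked {C} blocked C∉G = C , (C , here refl , ≈C-refl) , blocked , λ D → mk⇔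
  (λ { (C' , C'∈G , D≈C') → (C' , there C'∈G , D≈C') ,
                             λ D≈C → C∉G (C' , C'∈G , ≈C-trans (≈C-sym D≈C) D≈C') })
  (λ { ((_ , here refl , D≈C) , D≉C) → ⊥-elim (D≉C D≈C)
     ; ((C' , there C'∈G , D≈C') , _) → C' , C'∈G , D≈C' })

resolvent : Lit → Clause → Clause → Clause
resolvent l C C' = filter (λ k → ¬? (k ≟L l)) C ++ filter (λ k → ¬? (k ≟L ‾ l)) C'

∈-resolvent : ∀ {C l C' k} → InResolvent C l C' k → k ∈ resolvent l C C'
∈-resolvent (inj₁ (k∈C , k≢l))   = ∈-++⁺ˡ (∈-filter⁺ (λ k → ¬? (k ≟L _)) k∈C k≢l)
∈-resolvent (inj₂ (k∈C' , k≢l̄)) = ∈-++⁺ʳ _ (∈-filter⁺ (λ k → ¬? (k ≟L _)) k∈C' k≢l̄)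

TautologyFree : Clause → Set
TautologyFree R = All (λ k → ‾ k ∉ R) R

tautologyFree? : ∀ R → Dec (TautologyFree R)
tautologyFree? R = all? (λ k → ¬? (‾ k ∈? R)) R

tautologyFree⇒¬Tautological : ∀ {C l C'} → TautologyFree (resolvent l C C') →
                              ¬ Tautological (InResolvent C l C')
tautologyFree⇒¬Tautological free (k , k∈ , k̄∈) = lookup free (∈-resolvent k∈) (∈-resolvent k̄∈)

¬Blocks-by : ∀ {F l C C'} → C' ∈ F → ‾ l ∈ C' →
             {True (tautologyFree? (resolvent l C C'))} → ¬ Blocks F l C
¬Blocks-by C'∈F l̄∈C' {free} (_ , tautological) =
  tautologyFree⇒¬Tautological (toWitness free) (tautological _ C'∈F l̄∈C')

a b c d : Lit
a = pos 0
b = pos 1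
c = pos 2
d = pos 3

F* F : Formula
F* = (a ∷ b ∷ []) ∷ (‾ a ∷ c ∷ []) ∷ (‾ b ∷ ‾ c ∷ []) ∷ []
F  = (a ∷ d ∷ []) ∷ F*

φ : Lit → Lit
φ (pos 0) = pos 1
φ (pos 1) = pos 0
φ (pos 2) = neg 2
φ (neg 0) = neg 1
φ (neg 1) = neg 0
φ (neg 2) = pos 2
φ l       = l

φ-involutive : ∀ l → φ (φ l) ≡ l
φ-involutive (pos 0)                   = refl
φ-involutive (pos 1)                   = refl
φ-involutive (pos 2)                   = refl
φ-involutive (pos (suc (suc (suc _)))) = refl
φ-involutive (neg 0)                   = refl
φ-involutive (neg 1)                   = refl
φ-involutive (neg 2)                   = refl
φ-involutive (neg (suc (suc (suc _)))) = refl

‾-φ : ∀ l → ‾ (φ l) ≡ φ (‾ l)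
‾-φ (pos 0)                   = refl
‾-φ (pos 1)                   = refl
‾-φ (pos 2)                   = refl
‾-φ (pos (suc (suc (suc _)))) = refl
‾-φ (neg 0)                   = refl
‾-φ (neg 1)                   = refl
‾-φ (neg 2)                   = refl
‾-φ (neg (suc (suc (suc _)))) = refl

φ-fixes-outside-F* : ∀ l → l ∈Lit F* ⊎ φ l ≡ l
φ-fixes-outside-F* (pos 0)                   = inj₁ (occurs⇒∈Lit (here refl) (here refl))
φ-fixes-outside-F* (pos 1)                   = inj₁ (occurs⇒∈Lit (here refl) (there (here refl)))
φ-fixes-outside-F* (pos 2)                   = inj₁ (occurs⇒∈Lit (there (here refl)) (there (here refl)))
φ-fixes-outside-F* (pos (suc (suc (suc _)))) = inj₂ refl
φ-fixes-outside-F* (neg 0)                   = inj₁ (occurs‾⇒∈Lit (here refl) (here refl))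
φ-fixes-outside-F* (neg 1)                   = inj₁ (occurs‾⇒∈Lit (here refl) (there (here refl)))
φ-fixes-outside-F* (neg 2)                   = inj₁ (occurs‾⇒∈Lit (there (here refl)) (there (here refl)))
φ-fixes-outside-F* (neg (suc (suc (suc _)))) = inj₂ refl

F*⊑φF* : F* ⊑ applyF φ F*
F*⊑φF* _ (here refl)                 = _ , here refl , ≈C-swap a b
F*⊑φF* _ (there (here refl))         = _ , there (there (here refl)) , ≈C-refl
F*⊑φF* _ (there (there (here refl))) = _ , there (here refl) , ≈C-refl

φF*⊑F* : applyF φ F* ⊑ F*
φF*⊑F* _ (here refl)                 = _ , here refl , ≈C-swap b a
φF*⊑F* _ (there (here refl))         = _ , there (there (here refl)) , ≈C-refl
φF*⊑F* _ (there (there (here refl))) = _ , there (here refl) , ≈C-refl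

F*-unblocked : ∀ C → C ∈ F* → ¬ Blocked F* C
F*-unblocked _ (here refl)                 (_ , blocks@(here refl , _))         = ¬Blocks-by (there (here refl)) (here refl) blocks
F*-unblocked _ (here refl)                 (_ , blocks@(there (here refl) , _)) = ¬Blocks-by (there (there (here refl))) (here refl) blocks
F*-unblocked _ (there (here refl))         (_ , blocks@(here refl , _))         = ¬Blocks-by (here refl) (here refl) blocks
F*-unblocked _ (there (here refl))         (_ , blocks@(there (here refl) , _)) = ¬Blocks-by (there (there (here refl))) (there (here refl)) blocks
F*-unblocked _ (there (there (here refl))) (_ , blocks@(here refl , _))         = ¬Blocks-by (here refl) (there (here refl)) blocks
F*-unblocked _ (there (there (here refl))) (_ , blocks@(there (here refl) , _)) = ¬Blocks-by (there (here refl)) (there (here refl)) blocks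

F→F* : BCEStep F F*
F→F* = removeBlocked (d , pure⇒Blocks (there (here refl)) (absentFrom (‾ d) F))
                     (literal⇒∉F (there (here refl)) (absentFrom d F*))

σ : ℕ → Bool
σ 0 = true
σ 2 = true
σ _ = false

F-satisfied : ∀ C → C ∈ F → ∃ λ l → l ∈ C × TrueIn F σ l
F-satisfied _ (here refl)                         = a , here refl , occurs⇒∈Lit (here refl) (here refl) , refl
F-satisfied _ (there (here refl))                 = a , here refl , occurs⇒∈Lit (here refl) (here refl) , refl
F-satisfied _ (there (there (here refl)))         = c , there (here refl) , occurs⇒∈Lit (there (there (here refl))) (there (here refl)) , refl
F-satisfied _ (there (there (there (here refl)))) = ‾ b , here refl , occurs⇒∈Lit (there (there (there (here refl)))) (here refl) , refl

φ[a∨d]-falsified : ∀ l → l ∈ map φ (a ∷ d ∷ []) → TrueIn F σ (‾ l)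
φ[a∨d]-falsified _ (here refl)         = occurs⇒∈Lit (there (there (there (here refl)))) (here refl) , refl
φ[a∨d]-falsified _ (there (here refl)) = occurs‾⇒∈Lit (here refl) (there (here refl)) , refl

φ-not-SemSym-F : ¬ SemSym F φ
φ-not-SemSym-F symmetry =
  satisfied⇒¬InRestr F-satisfied
    (from (SemSym.sem symmetry σ []) (falsified⇒[]∈Restr (here refl) φ[a∨d]-falsified))

corollary2 : ∃ λ F → ∃ λ F* → ExhaustiveBCE F F* × (∃ λ φ → ∃ λ ψ → SemSym F* φ × LiftOf F* F φ ψ × ¬ SemSym F ψ)
corollary2 =
  F , F* , (F→F* ◅ ε , F*-unblocked) ,
  φ , φ , syntactic⇒SemSym φ-involutive ‾-φ F*⊑φF* φF*⊑F* ,
  liftOf-self φ-fixes-outside-F* , φ-not-SemSym-F
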